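{- Let $G$ be a directed acyclic graph on $[n]$ with edges $(i,j)$, $i<j$, and let $H\subseteq G$ be a path consistent subgraph which is admissible with respect to $G$. Then there is a vector $\mathbf d=(d_v)_{v\in V(H_{\mathrm{comp}})}\in\mathbb R^{V(H_{\mathrm{comp}})}$ such that $\mathsf{wd}(e)+d_{s(e)}-d_{t(e)}>-1$ for every edge $e\in E(H_{\mathrm{comp}})$, where $s(e),t(e)$ are the source and target of $e$.
   Context: A subgraph $H\subseteq G$ has $V(H)=V(G)$, $E(H)\subseteq E(G)$; $H^{\mathrm{un}}$ is its underlying undirected graph. Signed length of an undirected path in $H^{\mathrm{un}}$ from $u$ to $v$: number of edges traversed in their direction minus number traversed against it. $H$ is path consistent if any two undirected paths in $H^{\mathrm{un}}$ with the same endpoints $u,v$ have equal signed length $\ell_{uv}$. Weight function $w$: on each component $C$ of $H^{\mathrm{un}}$ pick $u_*\in C$ with $\ell_{u_*v_*}=\max_{u,v\in C}\ell_{uv}$ for some $v_*$, and set $w(i)=\ell_{u_*i}$ (independent of choice). $H_{\mathrm{comp}}$: directed multigraph whose vertices are the components of $H^{\mathrm{un}}$, with one edge $e$ from the component of $v$ to that of $v'$ for each $(v,v')\in E(G)\setminus E(H)$; its weight decrease is $\mathsf{wd}(e)=w(v)-w(v')$. $H$ is admissible if for every directed cycle $\mathcal C$ of $H_{\mathrm{comp}}$ (loops included), $\sum_{e\in\mathcal C}\mathsf{wd}(e)>-|\mathcal C|$, $|\mathcal C|$ the number of edges. -}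

module Defs where

open import Data.Nat using (ℕ; zero; suc)
open import Data.Fin using (Fin; zero; suc; inject₁; fromℕ; _<_)
open import Data.Bool using (Bool; true; false)
open import Data.List using (List; []; _∷_)
open import Data.List.Relation.Unary.Unique.Propositional using (Unique)
open import Data.Product using (Σ; ∃; ∃-syntax; _×_; _,_; proj₁; proj₂)
open import Data.Integer as ℤ using (ℤ; +_; -[1+_])
open import Relation.Binary.PropositionalEquality using (_≡_; _≢_)
open import Relation.Nullary using (¬_)
open import Data.Rational as ℚ using (ℚ; _/_)

Digraph : ℕ → Set
Digraph n = Fin n → Fin n → Bool

IsForwardDAG : ∀ {n} → Digraph n → Set
IsForwardDAG {n} G = ∀ (i j : Fin n) → G i j ≡ true → i < j

IsSubgraph : ∀ {n} → Digraph n → Digraph n → Set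
IsSubgraph {n} H G = ∀ (i j : Fin n) → H i j ≡ true → G i j ≡ true

-- Undirected walks in H^un, recording the direction of each traversed edge.
data UWalk {n : ℕ} (H : Digraph n) : Fin n → Fin n → Set where
  stop : (u : Fin n) → UWalk H u u
  fwd  : {u v w : Fin n} → H u v ≡ true → UWalk H v w → UWalk H u w
  bwd  : {u v w : Fin n} → H v u ≡ true → UWalk H v w → UWalk H u w

vertices : ∀ {n} {H : Digraph n} {u v} → UWalk H u v → List (Fin n)
vertices (stop u) = u ∷ []
vertices {u = u} (fwd _ p) = u ∷ vertices p
vertices {u = u} (bwd _ p) = u ∷ vertices p

signedLength : ∀ {n} {H : Digraph n} {u v} → UWalk H u v → ℤ
signedLength (stop _) = + 0
signedLength (fwd _ p) = + 1 ℤ.+ signedLength p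
signedLength (bwd _ p) = ℤ.- (+ 1) ℤ.+ signedLength p

UPath : ∀ {n} → Digraph n → Fin n → Fin n → Set
UPath H u v = Σ (UWalk H u v) λ p → Unique (vertices p)

pathLength : ∀ {n} {H : Digraph n} {u v} → UPath H u v → ℤ
pathLength p = signedLength (proj₁ p)

Connected : ∀ {n} → Digraph n → Fin n → Fin n → Set
Connected H u v = UPath H u v

PathConsistent : ∀ {n} → Digraph n → Set
PathConsistent {n} H =
  ∀ (u v : Fin n) (p q : UPath H u v) → pathLength p ≡ pathLength q

-- w is the weight function of H: for each vertex i, with C its component,
-- there are u* , v* ∈ C with ℓ(u*,v*) = max_{u,v ∈ C} ℓ(u,v) and w i = ℓ(u*,i).
IsWeightFunction : ∀ {n} → Digraph n → (Fin n → ℤ) → Set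
IsWeightFunction {n} H w =
  ∀ (i : Fin n) → ∃[ u* ] ∃[ v* ]
    Connected H u* i × Connected H v* i ×
    Σ (UPath H u* v*) λ p →
      (∀ (u v : Fin n) → Connected H u i → Connected H v i →
         (q : UPath H u v) → pathLength q ℤ.≤ pathLength p) ×
      Σ (UPath H u* i) λ r → w i ≡ pathLength r

-- an edge of H_comp: an edge (v , v') of G that is not in H
CompEdge : ∀ {n} → Digraph n → Digraph n → Fin n → Fin n → Set
CompEdge G H v v' = G v v' ≡ true × H v v' ≡ false

wd : ∀ {n} → (Fin n → ℤ) → Fin n → Fin n → ℤ
wd w v v' = w v ℤ.- w v'

sumFin : (k : ℕ) → (Fin k → ℤ) → ℤ
sumFin zero f = + 0
sumFin (suc k) f = f zero ℤ.+ sumFin k (λ i → f (suc i))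

-- A directed cycle of H_comp with suc m edges (loops: m = 0), given by
-- G-edges e i = (s i , t i) ∉ H, where the component of t i equals the
-- component of s (i+1) (cyclically), and the components of the s i
-- (the vertices of the cycle) are pairwise distinct.
record CompCycle {n : ℕ} (G H : Digraph n) (m : ℕ) : Set where
  field
    src tgt  : Fin (suc m) → Fin n
    isEdge   : ∀ i → CompEdge G H (src i) (tgt i)
    linked   : ∀ (i : Fin m) → Connected H (tgt (inject₁ i)) (src (suc i))
    closed   : Connected H (tgt (fromℕ m)) (src zero)
    distinct : ∀ (i j : Fin (suc m)) → i ≢ j → ¬ Connected H (src i) (src j)

Admissible : ∀ {n} → Digraph n → Digraph n → (Fin n → ℤ) → Set
Admissible {n} G H w =
  ∀ (m : ℕ) (C : CompCycle G H m) →
    ℤ.- (+ suc m) ℤ.< sumFin (suc m) (λ i → wd w (CompCycle.src C i) (CompCycle.tgt C i))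

toℚ : ℤ → ℚ
toℚ z = z / 1

module Submission where

-- Lemma 3.19 (only admissibility is needed).  Put K = n + 1 and let the
-- H_comp-edge (s , t) cost c s t = K · (wd s t + 1) − 1.  It suffices to find an
-- integer q, constant on the components of H^un, with q t ≤ q s + c s t on every
-- H_comp-edge: then d = q / K satisfies wd s t + d s − d t ≥ −1 + 1/K.
--
-- Such a q is a feasible potential (Bellman–Ford) of the constraint graph with
-- the H-edges in both directions at cost 0 and the H_comp-edges at cost c; its
-- walks are "mixed walks", H-walks interleaved with H_comp-edges.  Feasible
-- potentials exist once walk costs are bounded below, and they are:
--   * a closed mixed walk whose sources lie in distinct components is a directed
--     cycle of H_comp with at most n edges; admissibility gives it cost ≥ K − n;
--   * any other closed mixed walk "pinches" at two H-connected sources into two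
--     shorter closed ones, so every closed mixed walk has positive cost;
--   * pinching at a repeated source shortens a walk without raising its cost, so
--     each walk costs at least as much as one with at most n H_comp-edges.

open import Defs
open import Data.Nat using (ℕ)
open import Data.Fin using (Fin)
open import Data.Integer using (ℤ)
open import Data.Product using (Σ; _×_)
open import Relation.Binary.PropositionalEquality using (_≡_)
open import Data.List using (List)

module UndirectedWalks {n : ℕ} (H : Digraph n) where
  open import Data.Fin using (_≟_)
  open import Data.List.Relation.Unary.Any using (Any; here; there; any?)
  open import Data.List.Relation.Unary.All.Properties using (¬Any⇒All¬)
  open import Data.List.Relation.Unary.All using ([])
  open import Data.List.Relation.Unary.AllPairs using ([]; _∷_)
  open import Data.List.Relation.Unary.Unique.Propositional using (Unique)
  open import Data.Product using (_,_)
  open import Relation.Nullary using (yes; no)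
  open import Relation.Binary.PropositionalEquality using (refl)

  infixr 5 _++_

  _++_ : ∀ {a b c} → UWalk H a b → UWalk H b c → UWalk H a c
  stop _  ++ q = q
  fwd e p ++ q = fwd e (p ++ q)
  bwd e p ++ q = bwd e (p ++ q)

  reverse : ∀ {a b} → UWalk H a b → UWalk H b a
  reverse (stop u)          = stop u
  reverse (fwd {u = u} e p) = reverse p ++ bwd e (stop u)
  reverse (bwd {u = u} e p) = reverse p ++ fwd e (stop u)

  pathFrom : ∀ {u v w} (p : UWalk H v w) → Unique (vertices p) →
             Any (u ≡_) (vertices p) → UPath H u w
  pathFrom (stop v)  uq       (here refl) = stop v , uq
  pathFrom (fwd e p) uq       (here refl) = fwd e p , uq
  pathFrom (bwd e p) uq       (here refl) = bwd e p , uq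
  pathFrom (fwd e p) (_ ∷ uq) (there m)   = pathFrom p uq m
  pathFrom (bwd e p) (_ ∷ uq) (there m)   = pathFrom p uq m

  toPath : ∀ {u v} → UWalk H u v → UPath H u v
  toPath (stop u) = stop u , [] ∷ []
  toPath (fwd {u = u} e p) with toPath p
  ... | q , uq with any? (u ≟_) (vertices q)
  ...   | yes u∈q = pathFrom q uq u∈q
  ...   | no  u∉q = fwd e q , ¬Any⇒All¬ _ u∉q ∷ uq
  toPath (bwd {u = u} e p) with toPath p
  ... | q , uq with any? (u ≟_) (vertices q)
  ...   | yes u∈q = pathFrom q uq u∈q
  ...   | no  u∉q = bwd e q , ¬Any⇒All¬ _ u∉q ∷ uq

module SumsAndMinima where
  open import Data.Nat using (zero; suc)
  open import Data.Fin using (zero; suc)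
  open import Data.Integer using (+_; _+_; _-_; _*_; _≤_; _<_)
  import Data.Integer.Properties as ℤP
  open import Data.Integer.Tactic.RingSolver using (solve-∀)
  open import Data.List using (List; concatMap; allFin)
  open import Data.List.Membership.Propositional using (_∈_)
  open import Data.List.Membership.Propositional.Properties using (∈-map⁺; ∈-concat⁺′; ∈-allFin)
  open import Data.List.Relation.Unary.All as All using (All)
  open import Data.List.Relation.Unary.All.Properties using (concat⁺; map⁺)
  open import Data.List.Extrema ℤP.≤-totalOrder using (min; min≤⊤; min≤xs; argmin-all)
  open import Function using (id; _∘_)
  open import Relation.Binary.PropositionalEquality using (cong; trans)

  sumFin-mono : ∀ k {f g : Fin k → ℤ} → (∀ i → f i ≤ g i) → sumFin k f ≤ sumFin k g
  sumFin-mono zero    f≤g = ℤP.≤-refl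
  sumFin-mono (suc k) f≤g = ℤP.+-mono-≤ (f≤g zero) (sumFin-mono k (f≤g ∘ suc))

  sumFin-mono-< : ∀ k {f g : Fin k → ℤ} → (∀ i → f i ≤ g i) →
                  (j : Fin k) → f j < g j → sumFin k f < sumFin k g
  sumFin-mono-< (suc k) f≤g zero    fj<gj = ℤP.+-mono-<-≤ fj<gj (sumFin-mono k (f≤g ∘ suc))
  sumFin-mono-< (suc k) f≤g (suc j) fj<gj =
    ℤP.+-mono-≤-< (f≤g zero) (sumFin-mono-< k (f≤g ∘ suc) j fj<gj)

  sumFin-affine : ∀ k (K : ℤ) (f : Fin k → ℤ) →
    sumFin k (λ i → K * (f i + + 1) - + 1) ≡ K * (sumFin k f + + k) - + k
  sumFin-affine zero    K f = empty K
    where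
    empty : ∀ K → + 0 ≡ K * (+ 0 + + 0) - + 0
    empty = solve-∀
  sumFin-affine (suc k) K f =
    trans (cong (_+_ (K * (f zero + + 1) - + 1)) (sumFin-affine k K (f ∘ suc)))
          (regroup K (f zero) (sumFin k (f ∘ suc)) (+ k))
    where
    regroup : ∀ K a S k → (K * (a + + 1) - + 1) + (K * (S + k) - k)
                          ≡ K * ((a + S) + (+ 1 + k)) - (+ 1 + k)
    regroup = solve-∀

  minOver : ∀ {n} → ℤ → (Fin n → List ℤ) → ℤ
  minOver {n} d xs = min d (concatMap xs (allFin n))

  minOver-≤-default : ∀ {n} d (xs : Fin n → List ℤ) → minOver d xs ≤ d
  minOver-≤-default {n} d xs = min≤⊤ d (concatMap xs (allFin n))

  minOver-≤ : ∀ {n} d (xs : Fin n → List ℤ) i {x} → x ∈ xs i → minOver d xs ≤ x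
  minOver-≤ {n} d xs i x∈xsi =
    All.lookup (min≤xs d (concatMap xs (allFin n)))
               (∈-concat⁺′ x∈xsi (∈-map⁺ xs (∈-allFin i)))

  minOver-sel : ∀ {n} d (xs : Fin n → List ℤ) (P : ℤ → Set) →
                P d → (∀ i {x} → x ∈ xs i → P x) → P (minOver d xs)
  minOver-sel {n} d xs P Pd Pxs =
    argmin-all id {d} {concatMap xs (allFin n)} Pd
      (concat⁺ (map⁺ {xs = allFin n} (All.tabulate λ {i} _ → All.tabulate (Pxs i))))

-- Mixed walks: walks of the constraint graph, i.e. directed walks of H_comp
-- lifted to G.
module MixedWalks {n : ℕ} (G H : Digraph n) where
  open import Data.Nat as ℕ using (zero; suc; z≤n; s≤s)
  import Data.Nat.Properties as ℕP
  open import Data.Fin as Fin using (zero; suc; inject₁; fromℕ)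
  open import Data.Integer using (+_; _+_)
  import Data.Integer.Properties as ℤP
  open import Data.Integer.Tactic.RingSolver using (solve-∀)
  open import Relation.Binary.PropositionalEquality using (refl; cong; trans; sym)
  open import Relation.Nullary using (contradiction)
  open UndirectedWalks H

  data MixedWalk : Fin n → Fin n → Set where
    last : ∀ {a b} → UWalk H a b → MixedWalk a b
    cons : ∀ {a s t b} → UWalk H a s → CompEdge G H s t → MixedWalk t b → MixedWalk a b

  len : ∀ {a b} → MixedWalk a b → ℕ
  len (last _)     = 0
  len (cons _ _ W) = suc (len W)

  src tgt : ∀ {a b} (W : MixedWalk a b) → Fin (len W) → Fin n
  src (cons {s = s} _ _ _) zero    = s
  src (cons _ _ W)         (suc i) = src W i
  tgt (cons {t = t} _ _ _) zero    = t
  tgt (cons _ _ W)         (suc i) = tgt W i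

  edge : ∀ {a b} (W : MixedWalk a b) (i : Fin (len W)) → CompEdge G H (src W i) (tgt W i)
  edge (cons _ e _) zero    = e
  edge (cons _ _ W) (suc i) = edge W i

  between : ∀ {a s t b} (p : UWalk H a s) (e : CompEdge G H s t) (W : MixedWalk t b) (i : Fin (len W)) →
            UWalk H (tgt (cons p e W) (inject₁ i)) (src (cons p e W) (suc i))
  between p e (cons q f W) zero    = q
  between p e (cons q f W) (suc i) = between q f W i

  final : ∀ {a s t b} (p : UWalk H a s) (e : CompEdge G H s t) (W : MixedWalk t b) →
          UWalk H (tgt (cons p e W) (fromℕ (len W))) b
  final p e (last q)     = q
  final p e (cons q f W) = final q f W

  cost : ∀ {a b} → (Fin n → Fin n → ℤ) → MixedWalk a b → ℤ
  cost κ W = sumFin (len W) (λ i → κ (src W i) (tgt W i))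

  appendWalk : ∀ {a b b'} → MixedWalk a b → UWalk H b b' → MixedWalk a b'
  appendWalk (last q)     p = last (q ++ p)
  appendWalk (cons q e W) p = cons q e (appendWalk W p)

  appendEdge : ∀ {a b b'} → MixedWalk a b → CompEdge G H b b' → MixedWalk a b'
  appendEdge (last q)     e = cons q e (last (stop _))
  appendEdge (cons q e W) f = cons q e (appendEdge W f)

  cost-appendWalk : ∀ κ {a b b'} (W : MixedWalk a b) (p : UWalk H b b') →
                    cost κ (appendWalk W p) ≡ cost κ W
  cost-appendWalk κ (last q)                     p = refl
  cost-appendWalk κ (cons {s = s} {t = t} q e W) p = cong (_+_ (κ s t)) (cost-appendWalk κ W p)

  cost-appendEdge : ∀ κ {a b b'} (W : MixedWalk a b) (f : CompEdge G H b b') →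
                    cost κ (appendEdge W f) ≡ cost κ W + κ b b'
  cost-appendEdge κ {b = b} {b'} (last q) f =
    trans (ℤP.+-identityʳ (κ b b')) (sym (ℤP.+-identityˡ (κ b b')))
  cost-appendEdge κ {b = b} {b'} (cons {s = s} {t = t} q e W) f =
    trans (cong (_+_ (κ s t)) (cost-appendEdge κ W f)) (sym (ℤP.+-assoc (κ s t) (cost κ W) (κ b b')))

  length-induction : (P : ∀ {a b} → MixedWalk a b → Set) →
    (∀ {a b} (W : MixedWalk a b) →
       (∀ {a' b'} (V : MixedWalk a' b') → len V ℕ.< len W → P V) → P W) →
    ∀ {a b} (W : MixedWalk a b) → P W
  length-induction P step W = go (len W) W ℕP.≤-refl
    where
    go : ∀ m {a b} (W : MixedWalk a b) → len W ℕ.≤ m → P W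
    go zero    W bound = step W λ V V<W → contradiction (ℕP.<-≤-trans V<W bound) ℕP.n≮0
    go (suc m) W bound = step W λ V V<W → go m V (ℕ.s≤s⁻¹ (ℕP.<-≤-trans V<W bound))

  record Split {a b} (W : MixedWalk a b) (j : Fin (len W)) : Set where
    field
      before     : MixedWalk a (src W j)
      after      : MixedWalk (tgt W j) b
      len-split  : len W ≡ len before ℕ.+ suc (len after)
      cost-split : ∀ κ → cost κ W ≡ cost κ before + (κ (src W j) (tgt W j) + cost κ after)

  splitAt : ∀ {a b} (W : MixedWalk a b) (j : Fin (len W)) → Split W j
  splitAt (cons p e W) zero = record
    { before = last p ; after = W ; len-split = refl
    ; cost-split = λ κ → sym (ℤP.+-identityˡ _) }
  splitAt (cons {s = s} {t = t} p e W) (suc j) = record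
    { before     = cons p e before
    ; after      = after
    ; len-split  = cong suc len-split
    ; cost-split = λ κ → trans (cong (_+_ (κ s t)) (cost-split κ)) (sym (ℤP.+-assoc (κ s t) _ _)) }
    where open Split (splitAt W j)

  record Pinch {a b} (W : MixedWalk a b) (i j : Fin (len W)) : Set where
    field
      loop          : MixedWalk (src W i) (src W j)
      rest          : MixedWalk a b
      loop-nonempty : 0 ℕ.< len loop
      rest-nonempty : 0 ℕ.< len rest
      len-pinch     : len W ≡ len loop ℕ.+ len rest
      cost-pinch    : ∀ κ → cost κ W ≡ cost κ loop + cost κ rest

  pinch : ∀ {a b} (W : MixedWalk a b) (i j : Fin (len W)) → i Fin.< j →
          UWalk H (src W i) (src W j) → Pinch W i j
  pinch (cons {s = s} {t = t} p e W) zero (suc j) _ w = record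
    { loop          = cons (stop s) e before
    ; rest          = cons (p ++ w) (edge W j) after
    ; loop-nonempty = s≤s z≤n
    ; rest-nonempty = s≤s z≤n
    ; len-pinch     = cong suc len-split
    ; cost-pinch    = λ κ → trans (cong (_+_ (κ s t)) (cost-split κ))
                                  (sym (ℤP.+-assoc (κ s t) _ _)) }
    where open Split (splitAt W j)
  pinch (cons {s = s} {t = t} p e W) (suc i) (suc j) (s≤s i<j) w = record
    { loop          = loop
    ; rest          = cons p e rest
    ; loop-nonempty = loop-nonempty
    ; rest-nonempty = s≤s z≤n
    ; len-pinch     = trans (cong suc len-pinch) (sym (ℕP.+-suc (len loop) (len rest)))
    ; cost-pinch    = λ κ → trans (cong (_+_ (κ s t)) (cost-pinch κ))
                                  (left-comm (κ s t) (cost κ loop) (cost κ rest)) }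
    where
    open Pinch (pinch W i j i<j w)
    left-comm : ∀ x y z → x + (y + z) ≡ y + (x + z)
    left-comm = solve-∀

  module _ {a b} {W : MixedWalk a b} {i j} (P : Pinch W i j) where
    open Pinch P

    loop-shorter : len loop ℕ.< len W
    loop-shorter rewrite len-pinch = ℕP.m<m+n (len loop) rest-nonempty

    rest-shorter : len rest ℕ.< len W
    rest-shorter rewrite len-pinch = ℕP.m<n+m (len rest) loop-nonempty

module ClosedWalks {n : ℕ} (G H : Digraph n) (κ : Fin n → Fin n → ℤ) where
  open import Data.Nat as ℕ using (suc; z≤n; s≤s; _≤?_)
  import Data.Nat.Properties as ℕP
  open import Data.Fin using (_<_)
  open import Data.Fin.Properties using (<-cmp; pigeonhole)
  open import Data.Integer using (+_; _+_; _*_; _≤_; +≤+)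
  import Data.Integer.Properties as ℤP
  open import Data.Integer.Tactic.RingSolver using (solve-∀)
  open import Data.List using (List; map; allFin)
  open import Data.List.Membership.Propositional.Properties using (∈-map⁺; ∈-allFin)
  open import Data.Empty using (⊥-elim)
  open import Data.Product using (_,_)
  open import Data.Sum using (_⊎_; inj₁; inj₂)
  open import Relation.Binary.Definitions using (tri<; tri≈; tri>)
  open import Relation.Binary.PropositionalEquality using (_≢_; sym; subst)
  open import Relation.Nullary using (¬_; yes; no)
  open import Relation.Nullary.Decidable using (decidable-stable)
  open UndirectedWalks H
  open MixedWalks G H
  open SumsAndMinima using (minOver; minOver-≤; minOver-≤-default)

  SeparatedSources : ∀ {a b} → MixedWalk a b → Set
  SeparatedSources W = ∀ i j → i ≢ j → ¬ UWalk H (src W i) (src W j)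

  -- Closed mixed walks with separated sources are the directed cycles of H_comp.
  CyclesPositive : Set
  CyclesPositive = ∀ {a b} (W : MixedWalk a b) → UWalk H b a → 0 ℕ.< len W →
                   SeparatedSources W → + 1 ≤ cost κ W

  PositiveIfClosed : ∀ {a b} → MixedWalk a b → Set
  PositiveIfClosed {a} {b} W = UWalk H b a → 0 ℕ.< len W → + 1 ≤ cost κ W

  ClosedWalksPositive : Set
  ClosedWalksPositive = ∀ {a b} (W : MixedWalk a b) → PositiveIfClosed W

  record LinkedSources {a b} (W : MixedWalk a b) : Set where
    field
      i j  : Fin (len W)
      i<j  : i < j
      link : UWalk H (src W i) (src W j)

  -- Connectivity is not decided here, but the dichotomy holds up to double
  -- negation, which suffices for proving the decidable claim `+ 1 ≤ cost κ W`.
  linked-or-separated : ∀ {a b} (W : MixedWalk a b) →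
                        ¬ ¬ (LinkedSources W ⊎ SeparatedSources W)
  linked-or-separated W neither =
    neither (inj₂ λ i j i≢j w → neither (inj₁ (ordered i j i≢j w)))
    where
    ordered : ∀ i j → i ≢ j → UWalk H (src W i) (src W j) → LinkedSources W
    ordered i j i≢j w with <-cmp i j
    ... | tri< i<j _   _   = record { i = i ; j = j ; i<j = i<j ; link = w }
    ... | tri≈ _   i≡j _   = ⊥-elim (i≢j i≡j)
    ... | tri> _   _   j<i = record { i = j ; j = i ; i<j = j<i ; link = reverse w }

  -- Cycle decomposition: a closed walk with linked sources is the sum of two
  -- shorter closed walks (the loop closes along the reversed link), so
  -- positivity on cycles propagates to all closed walks.
  cycles-suffice : CyclesPositive → ClosedWalksPositive
  cycles-suffice cycles = length-induction PositiveIfClosed step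
    where
    step : ∀ {a b} (W : MixedWalk a b) →
           (∀ {a' b'} (V : MixedWalk a' b') → len V ℕ.< len W → PositiveIfClosed V) →
           PositiveIfClosed W
    step W shorter back nonempty =
      decidable-stable (+ 1 ℤP.≤? cost κ W) λ notPositive → linked-or-separated W λ where
        (inj₂ separated) → notPositive (cycles W back nonempty separated)
        (inj₁ linked)    → notPositive (via-pinch linked)
      where
      via-pinch : LinkedSources W → + 1 ≤ cost κ W
      via-pinch linked = subst (+ 1 ≤_) (sym (cost-pinch κ))
        (ℤP.≤-trans (+≤+ (s≤s z≤n))
          (ℤP.+-mono-≤ (shorter loop (loop-shorter P) (reverse link) loop-nonempty)
                       (shorter rest (rest-shorter P) back rest-nonempty)))
        where
        open LinkedSources linked
        P : Pinch W i j
        P = pinch W i j i<j link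
        open Pinch P

  rest-cheaper : ClosedWalksPositive → ∀ {a b} {W : MixedWalk a b} {i j} (P : Pinch W i j) →
                 UWalk H (src W j) (src W i) → cost κ (Pinch.rest P) ≤ cost κ W
  rest-cheaper positive P back = subst (cost κ rest ≤_) (sym (cost-pinch κ))
    (subst (_≤ cost κ loop + cost κ rest) (ℤP.+-identityˡ (cost κ rest))
      (ℤP.+-monoˡ-≤ (cost κ rest) (ℤP.≤-trans (+≤+ z≤n) (positive loop back loop-nonempty))))
    where open Pinch P

  -- A walk with more than n H_comp-edges repeats a source, and pinching there
  -- makes it shorter and no more expensive.
  HasShortening : ∀ {a b} → MixedWalk a b → Set
  HasShortening {a} {b} W = Σ (MixedWalk a b) λ V → len V ℕ.≤ n × cost κ V ≤ cost κ W

  shorten : ClosedWalksPositive → ∀ {a b} (W : MixedWalk a b) → HasShortening W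
  shorten positive = length-induction HasShortening step
    where
    step : ∀ {a b} (W : MixedWalk a b) →
           (∀ {a' b'} (V : MixedWalk a' b') → len V ℕ.< len W → HasShortening V) →
           HasShortening W
    step W shorter with len W ≤? n
    ... | yes short = W , short , ℤP.≤-refl
    ... | no long with pigeonhole (ℕP.≰⇒> long) (src W)
    ...   | i , j , i<j , same =
      let P                    = pinch W i j i<j repeat
          (V , short , V≤rest) = shorter (Pinch.rest P) (rest-shorter P)
      in V , short , ℤP.≤-trans V≤rest (rest-cheaper positive P (reverse repeat))
      where
      repeat : UWalk H (src W i) (src W j)
      repeat = subst (UWalk H (src W i)) same (stop _)

  short-walk-bound : ∀ k → k ≤ + 0 → (∀ s t → k ≤ κ s t) →
                     ∀ m {a b} (W : MixedWalk a b) → len W ℕ.≤ m → + m * k ≤ cost κ W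
  short-walk-bound k k≤0 k≤κ m (last _) _ =
    subst (+ m * k ≤_) (ℤP.*-zeroʳ (+ m)) (ℤP.*-monoˡ-≤-nonNeg (+ m) k≤0)
  short-walk-bound k k≤0 k≤κ (suc m) W@(cons {s = s} {t = t} _ _ V) (s≤s V≤m) =
    subst (_≤ cost κ W) (sym (unfold k (+ m)))
      (ℤP.+-mono-≤ (k≤κ s t) (short-walk-bound k k≤0 k≤κ m V V≤m))
    where
    unfold : ∀ k m → (+ 1 + m) * k ≡ k + m * k
    unfold = solve-∀

  walk-costs-bounded : ClosedWalksPositive →
                       Σ ℤ λ B → ∀ {a b} (W : MixedWalk a b) → B ≤ cost κ W
  walk-costs-bounded positive = + n * k , bound
    where
    costsFrom : Fin n → List ℤ
    costsFrom s = map (κ s) (allFin n)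
    k : ℤ
    k = minOver (+ 0) costsFrom
    k≤κ : ∀ s t → k ≤ κ s t
    k≤κ s t = minOver-≤ (+ 0) costsFrom s (∈-map⁺ (κ s) (∈-allFin t))
    bound : ∀ {a b} (W : MixedWalk a b) → + n * k ≤ cost κ W
    bound W with shorten positive W
    ... | V , short , V≤W =
      ℤP.≤-trans (short-walk-bound k (minOver-≤-default (+ 0) costsFrom) k≤κ n V short) V≤W

-- If walk costs are bounded below, relaxing q ↦ min (q y, q x + c)
-- from q = 0 stabilises, since relaxation keeps every value the cost of a walk
-- and strictly lowers the bounded-below total Σ q until q is stable.
module FeasiblePotentials {n : ℕ} (arcs : Fin n → Fin n → List ℤ) where
  open import Data.Nat using (zero; suc)
  open import Data.Fin.Properties using (all?; ¬∀⟶∃¬)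
  open import Data.Integer using (+_; -[1+_]; _+_; _-_; -_; _≤_; _<_; ∣_∣; pred; -≤+)
  import Data.Integer.Properties as ℤP
  open import Data.Integer.Tactic.RingSolver using (solve-∀)
  open import Data.List using (map)
  open import Data.List.Membership.Propositional using (_∈_)
  open import Data.List.Membership.Propositional.Properties using (∈-map⁺; ∈-map⁻)
  open import Data.Empty using (⊥-elim)
  open import Data.Product using (_,_)
  open import Relation.Binary.PropositionalEquality using (refl; subst)
  open import Relation.Nullary using (yes; no)
  open SumsAndMinima

  data Reachable : Fin n → ℤ → Set where
    start  : ∀ x → Reachable x (+ 0)
    extend : ∀ {x y v c} → Reachable x v → c ∈ arcs x y → Reachable y (v + c)

  Feasible : (Fin n → ℤ) → Set
  Feasible q = ∀ x y {c} → c ∈ arcs x y → q y ≤ q x + c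

  offers : (Fin n → ℤ) → Fin n → Fin n → List ℤ
  offers q y x = map (_+_ (q x)) (arcs x y)

  relax : (Fin n → ℤ) → Fin n → ℤ
  relax q y = minOver (q y) (offers q y)

  relax-≤ : ∀ q y → relax q y ≤ q y
  relax-≤ q y = minOver-≤-default (q y) (offers q y)

  relax-≤-offer : ∀ q x y {c} → c ∈ arcs x y → relax q y ≤ q x + c
  relax-≤-offer q x y c∈arcs = minOver-≤ (q y) (offers q y) x (∈-map⁺ (_+_ (q x)) c∈arcs)

  relax-reachable : ∀ q → (∀ x → Reachable x (q x)) → ∀ y → Reachable y (relax q y)
  relax-reachable q reach y = minOver-sel (q y) (offers q y) (Reachable y) (reach y) offered
    where
    offered : ∀ x {v} → v ∈ offers q y x → Reachable y v
    offered x v∈offers with ∈-map⁻ (_+_ (q x)) v∈offers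
    ... | c , c∈arcs , refl = extend (reach x) c∈arcs

  Stable : (Fin n → ℤ) → Set
  Stable q = ∀ y → relax q y ≡ q y

  stable⇒feasible : ∀ {q} → Stable q → Feasible q
  stable⇒feasible {q} stable x y c∈arcs = subst (_≤ q x + _) (stable y) (relax-≤-offer q x y c∈arcs)

  headroom : ∀ i j → i ≤ j + + ∣ i - j ∣
  headroom i j = subst (_≤ j + + ∣ i - j ∣) (regroup i j) (ℤP.+-monoʳ-≤ j (below-abs (i - j)))
    where
    regroup : ∀ i j → j + (i - j) ≡ i
    regroup = solve-∀
    below-abs : ∀ k → k ≤ + ∣ k ∣
    below-abs (+ _)    = ℤP.≤-refl
    below-abs -[1+ _ ] = -≤+

  module _ (B : ℤ) (bounded : ∀ {x v} → Reachable x v → B ≤ v) where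

    total : (Fin n → ℤ) → ℤ
    total q = sumFin n q

    floor : ℤ
    floor = sumFin n (λ _ → B)

    -- `fuel` bounds the number of further strict decreases of the total.
    iterate : (fuel : ℕ) (q : Fin n → ℤ) → (∀ x → Reachable x (q x)) →
              total q ≤ floor + + fuel → Σ (Fin n → ℤ) Stable
    iterate fuel q reach q≤ with all? (λ y → relax q y ℤP.≟ q y)
    ... | yes stable = q , stable
    ... | no unstable with ¬∀⟶∃¬ n _ (λ y → relax q y ℤP.≟ q y) unstable
    ...   | y , moved = continue fuel q≤
      where
      reach' : ∀ x → Reachable x (relax q x)
      reach' = relax-reachable q reach
      decreases : total (relax q) < total q
      decreases = sumFin-mono-< n (relax-≤ q) y (ℤP.≤∧≢⇒< (relax-≤ q y) moved)
      above-floor : floor ≤ total (relax q)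
      above-floor = sumFin-mono n (λ x → bounded (reach' x))
      continue : ∀ fuel → total q ≤ floor + + fuel → Σ (Fin n → ℤ) Stable
      -- with no fuel left, floor ≤ total (relax q) < total q ≤ floor is absurd;
      -- otherwise the strict decrease spends one unit of fuel
      continue zero    q≤ = ⊥-elim (ℤP.<-irrefl refl (ℤP.≤-<-trans
        (ℤP.≤-trans (subst (total q ≤_) (ℤP.+-identityʳ floor) q≤) above-floor) decreases))
      continue (suc f) q≤ = iterate f (relax q) reach'
        (ℤP.≤-trans (ℤP.i<j⇒i≤pred[j] decreases)
          (subst (pred (total q) ≤_) (spend floor (+ f)) (ℤP.pred-mono q≤)))
        where
        spend : ∀ k f → - + 1 + (k + (+ 1 + f)) ≡ k + f
        spend = solve-∀

    feasible-potential : Σ (Fin n → ℤ) Feasible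
    feasible-potential =
      let (q , stable) = iterate _ (λ _ → + 0) start (headroom (total (λ _ → + 0)) floor)
      in q , stable⇒feasible stable

-- The rational estimate: with K = k + 1, if y ≤ x + (K · (a + 1) − 1) then
-- a + x/K − y/K > −1.  In unnormalised rationals the claim is an integer
-- inequality between numerators and denominators.
module RationalEstimate where
  open import Data.Nat as ℕ using (suc; z≤n)
  import Data.Nat.Properties as ℕP
  open import Data.Integer as ℤ using (+_; -[1+_]; _+_; _-_; _*_; -_; _≤_; +≤+)
  import Data.Integer.Properties as ℤP
  open import Data.Integer.Tactic.RingSolver using (solve-∀)
  open import Data.Rational as ℚ using (toℚᵘ; 1ℚ)
  import Data.Rational.Properties as ℚP
  open import Data.Rational.Unnormalised as ℚᵘ using (ℚᵘ; mkℚᵘ; ↥_; ↧_; *<*; *≡*; _≃_)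
  import Data.Rational.Unnormalised.Properties as ℚᵘP
  open import Relation.Binary.PropositionalEquality using (refl; sym; cong; trans; subst; subst₂)

  shifted : ℤ → ℤ → ℤ → ℕ → ℚᵘ
  shifted a x y k = (mkℚᵘ a 0 ℚᵘ.+ mkℚᵘ x k) ℚᵘ.- mkℚᵘ y k

  to-shifted : ∀ a x y k →
    toℚᵘ ((toℚ a ℚ.+ x ℚ./ suc k) ℚ.- y ℚ./ suc k) ≃ shifted a x y k
  to-shifted a x y k =
    ℚᵘP.≃-trans (ℚP.toℚᵘ-homo-+ (toℚ a ℚ.+ x ℚ./ suc k) (ℚ.- (y ℚ./ suc k)))
                (ℚᵘP.+-cong sum negation)
    where
    sum : toℚᵘ (toℚ a ℚ.+ x ℚ./ suc k) ≃ mkℚᵘ a 0 ℚᵘ.+ mkℚᵘ x k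
    sum = ℚᵘP.≃-trans (ℚP.toℚᵘ-homo-+ (toℚ a) (x ℚ./ suc k))
            (ℚᵘP.+-cong (ℚP.toℚᵘ-fromℚᵘ (mkℚᵘ a 0)) (ℚP.toℚᵘ-fromℚᵘ (mkℚᵘ x k)))
    negation : toℚᵘ (ℚ.- (y ℚ./ suc k)) ≃ ℚᵘ.- mkℚᵘ y k
    negation = ℚᵘP.≃-trans (ℚP.toℚᵘ-homo‿- (y ℚ./ suc k)) (ℚᵘP.-‿cong (ℚP.toℚᵘ-fromℚᵘ (mkℚᵘ y k)))

  numerator : ∀ a x y k →
    ↥ shifted a x y k ≡ (a * + suc k + x * + 1) * + suc k + (- y) * + suc k
  numerator a x y k =
    cong (λ m → (a * + suc k + x * + 1) * + suc k + (- y) * + suc m) (ℕP.+-identityʳ k)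

  denominator : ∀ a x y k → ↧ shifted a x y k ≡ + suc k * + suc k
  denominator a x y k =
    trans (cong (λ m → + (suc m ℕ.* suc k)) (ℕP.+-identityʳ k)) (ℤP.pos-* (suc k) (suc k))

  -- the cross-multiplied inequality −1 · K² < numerator
  integer-estimate : ∀ a x y k → y ≤ x + (+ suc k * (a + + 1) - + 1) →
    ℤ.suc (-[1+ 0 ] * (+ suc k * + suc k)) ≤ ((a * + suc k + x * + 1) * + suc k + (- y) * + suc k) * + 1
  integer-estimate a x y k y≤ = ℤP.0≤i-j⇒j≤i (subst (+ 0 ≤_) (sym (difference a x y (+ k)))
    (ℤP.+-mono-≤ (ℤP.*-monoʳ-≤-nonNeg (+ suc k) (ℤP.i≤j⇒0≤j-i y≤)) (+≤+ z≤n)))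
    where
    difference : ∀ a x y k →
      ((a * (+ 1 + k) + x * + 1) * (+ 1 + k) + (- y) * (+ 1 + k)) * + 1
        - (+ 1 + (- + 1) * ((+ 1 + k) * (+ 1 + k)))
      ≡ ((x + ((+ 1 + k) * (a + + 1) - + 1)) - y) * (+ 1 + k) + k
    difference = solve-∀

  rational-estimate : ∀ a x y k → y ≤ x + (+ suc k * (a + + 1) - + 1) →
    ℚ.- 1ℚ ℚ.< (toℚ a ℚ.+ x ℚ./ suc k) ℚ.- y ℚ./ suc k
  rational-estimate a x y k y≤ =
    ℚP.toℚᵘ-cancel-< (ℚᵘP.<-respʳ-≃ (ℚᵘP.≃-sym (to-shifted a x y k))
      (ℚᵘP.<-respˡ-≃ minus-one (*<* (ℤP.suc[i]≤j⇒i<j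
        (subst₂ (λ N D → ℤ.suc (-[1+ 0 ] * D) ≤ N * + 1)
          (sym (numerator a x y k)) (sym (denominator a x y k)) (integer-estimate a x y k y≤))))))
    where
    minus-one : mkℚᵘ -[1+ 0 ] 0 ≃ toℚᵘ (ℚ.- 1ℚ)
    minus-one = *≡* refl

module ConstraintGraph {n : ℕ} (G H : Digraph n) (w : Fin n → ℤ) where
  open import Data.Nat as ℕ using (suc)
  open import Data.Fin using (_≟_)
  open import Data.Fin.Properties using (injective⇒≤)
  open import Data.Bool using (Bool; true; false; _∧_; not; if_then_else_)
  open import Data.Integer using (+_; _+_; _-_; _*_; -_; _≤_; _<_; +≤+)
  import Data.Integer.Properties as ℤP
  open import Data.Integer.Tactic.RingSolver using (solve-∀)
  open import Data.List as List using ([]; _∷_)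
  open import Data.List.Membership.Propositional using (_∈_)
  open import Data.List.Membership.Propositional.Properties using (∈-++⁻; ∈-++⁺ˡ; ∈-++⁺ʳ)
  open import Data.List.Relation.Unary.Any using (here)
  open import Data.Empty using (⊥-elim)
  open import Data.Product using (_,_; proj₁)
  open import Data.Sum using (_⊎_; inj₁; inj₂)
  open import Relation.Binary.PropositionalEquality using (refl; sym; trans; subst; cong₂)
  open import Relation.Nullary using (yes; no)
  open UndirectedWalks H
  open MixedWalks G H
  open SumsAndMinima using (sumFin-affine)

  K : ℤ
  K = + suc n

  c : Fin n → Fin n → ℤ
  c s t = K * (wd w s t + + 1) - + 1

  open ClosedWalks G H c

  cost-scaled : ∀ {a b} (W : MixedWalk a b) → cost c W ≡ K * (cost (wd w) W + + len W) - + len W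
  cost-scaled W = sumFin-affine (len W) K (λ i → wd w (src W i) (tgt W i))

  -- Separated sources are distinct vertices, so there are at most n of them.
  separated-length : ∀ {a b} (W : MixedWalk a b) → SeparatedSources W → len W ℕ.≤ n
  separated-length W separated = injective⇒≤ distinct
    where
    distinct : ∀ {i j} → src W i ≡ src W j → i ≡ j
    distinct {i} {j} same with i ≟ j
    ... | yes i≡j = i≡j
    ... | no  i≢j = ⊥-elim (separated i j i≢j (subst (UWalk H (src W i)) same (stop _)))

  trace : ∀ {a s t b} (p : UWalk H a s) (e : CompEdge G H s t) (W : MixedWalk t b) →
          UWalk H b a → SeparatedSources (cons p e W) → CompCycle G H (len W)
  trace p e W back separated = record
    { src      = src (cons p e W)
    ; tgt      = tgt (cons p e W)
    ; isEdge   = edge (cons p e W)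
    ; linked   = λ i → toPath (between p e W i)
    ; closed   = toPath (final p e W ++ back ++ p)
    ; distinct = λ i j i≢j connected → separated i j i≢j (proj₁ connected) }

  -- If −L < S (admissibility) and L ≤ n, then K · (S + L) − L ≥ K − n = 1.
  scaled-bound : ∀ S L → - + L < S → L ℕ.≤ n → + 1 ≤ K * (S + + L) - + L
  scaled-bound S L −L<S L≤n = subst (_≤ K * (S + + L) - + L) (K-n (+ n))
    (ℤP.+-mono-≤ (subst (_≤ K * (S + + L)) (ℤP.*-identityʳ K) (ℤP.*-monoˡ-≤-nonNeg K 1≤S+L))
                 (ℤP.neg-mono-≤ (+≤+ L≤n)))
    where
    K-n : ∀ n → (+ 1 + n) - n ≡ + 1
    K-n = solve-∀
    cancel : ∀ L → (+ 1 + - L) + L ≡ + 1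
    cancel = solve-∀
    1≤S+L : + 1 ≤ S + + L
    1≤S+L = subst (_≤ S + + L) (cancel (+ L)) (ℤP.+-monoˡ-≤ (+ L) (ℤP.i<j⇒suc[i]≤j −L<S))

  cycles-positive : Admissible G H w → CyclesPositive
  cycles-positive admissible W@(cons p e V) back _ separated =
    subst (+ 1 ≤_) (sym (cost-scaled W))
      (scaled-bound (cost (wd w) W) (len W) (admissible (len V) (trace p e V back separated))
                    (separated-length W separated))

  when : Bool → ℤ → List ℤ
  when b k = if b then k ∷ [] else []

  arcs : Fin n → Fin n → List ℤ
  arcs x y = when (H x y) (+ 0) List.++ when (H y x) (+ 0) List.++ when (G x y ∧ not (H x y)) (c x y)

  ∈-when⁻ : ∀ {b k k'} → k' ∈ when b k → b ≡ true × k' ≡ k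
  ∈-when⁻ {true} (here refl) = refl , refl

  ∈-when⁺ : ∀ {b k} → b ≡ true → k ∈ when b k
  ∈-when⁺ refl = here refl

  comp-flag : ∀ {g h} → g ∧ not h ≡ true → g ≡ true × h ≡ false
  comp-flag {true} {false} refl = refl , refl

  arc-kinds : ∀ {x y k} → k ∈ arcs x y →
              (k ≡ + 0 × UWalk H x y) ⊎ (k ≡ c x y × CompEdge G H x y)
  arc-kinds {x} {y} k∈arcs with ∈-++⁻ (when (H x y) (+ 0)) k∈arcs
  ... | inj₁ k∈fwd with ∈-when⁻ k∈fwd
  ...   | h , k≡0 = inj₁ (k≡0 , fwd h (stop y))
  arc-kinds {x} {y} k∈arcs | inj₂ k∈rest with ∈-++⁻ (when (H y x) (+ 0)) k∈rest
  ... | inj₁ k∈bwd with ∈-when⁻ k∈bwd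
  ...   | h , k≡0 = inj₁ (k≡0 , bwd h (stop y))
  arc-kinds {x} {y} k∈arcs | inj₂ k∈rest | inj₂ k∈comp with ∈-when⁻ k∈comp
  ... | flag , k≡c = inj₂ (k≡c , comp-flag flag)

  forward-arc : ∀ {x y} → H x y ≡ true → + 0 ∈ arcs x y
  forward-arc h = ∈-++⁺ˡ (∈-when⁺ h)

  backward-arc : ∀ {x y} → H x y ≡ true → + 0 ∈ arcs y x
  backward-arc {x} {y} h = ∈-++⁺ʳ (when (H y x) (+ 0)) (∈-++⁺ˡ (∈-when⁺ h))

  comp-arc : ∀ {x y} → CompEdge G H x y → c x y ∈ arcs x y
  comp-arc {x} {y} (g , h) = ∈-++⁺ʳ (when (H x y) (+ 0)) (∈-++⁺ʳ (when (H y x) (+ 0))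
    (∈-when⁺ (cong₂ (λ g h → g ∧ not h) g h)))

  open FeasiblePotentials arcs using (Reachable; start; extend; Feasible; feasible-potential)

  reachable-walk : ∀ {y v} → Reachable y v →
                   Σ (Fin n) λ a → Σ (MixedWalk a y) λ W → cost c W ≡ v
  reachable-walk (start x) = x , last (stop x) , refl
  reachable-walk (extend r k∈arcs) with reachable-walk r | arc-kinds k∈arcs
  ... | a , W , refl | inj₁ (refl , p) =
    a , appendWalk W p , trans (cost-appendWalk c W p) (sym (ℤP.+-identityʳ (cost c W)))
  ... | a , W , refl | inj₂ (refl , e) = a , appendEdge W e , cost-appendEdge c W e

  zero-arc : ∀ {q} → Feasible q → ∀ {x y} → + 0 ∈ arcs x y → q y ≤ q x
  zero-arc {q} feasible {x} {y} arc = subst (q y ≤_) (ℤP.+-identityʳ (q x)) (feasible x y arc)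

  constant-on-walks : ∀ {q} → Feasible q → ∀ {u v} → UWalk H u v → q u ≡ q v
  constant-on-walks feasible (stop _) = refl
  constant-on-walks feasible (fwd h p) =
    trans (ℤP.≤-antisym (zero-arc feasible (backward-arc h)) (zero-arc feasible (forward-arc h)))
          (constant-on-walks feasible p)
  constant-on-walks feasible (bwd h p) =
    trans (ℤP.≤-antisym (zero-arc feasible (forward-arc h)) (zero-arc feasible (backward-arc h)))
          (constant-on-walks feasible p)

  integer-potential : Admissible G H w →
    Σ (Fin n → ℤ) λ q → (∀ {u v} → UWalk H u v → q u ≡ q v) ×
                        (∀ s t → CompEdge G H s t → q t ≤ q s + c s t)
  integer-potential admissible =
    let (B , bounded)    = walk-costs-bounded (cycles-suffice (cycles-positive admissible))
        (q , feasible)   = feasible-potential B (reachable-bounded B bounded)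
    in q , constant-on-walks feasible , λ s t e → feasible s t (comp-arc e)
    where
    reachable-bounded : ∀ B → (∀ {a b} (W : MixedWalk a b) → B ≤ cost c W) →
                        ∀ {y v} → Reachable y v → B ≤ v
    reachable-bounded B bounded r with reachable-walk r
    ... | _ , W , refl = bounded W

open import Data.Rational using (ℚ; _+_; _-_; _<_; -_; 1ℚ; _/_)
open import Data.Nat using (suc)
open import Data.Product using (_,_; proj₁)
open import Relation.Binary.PropositionalEquality using (cong)

-- Take d v = q v / (n + 1) for the integer potential q: it is constant on
-- components, and the rational estimate turns q t ≤ q s + c s t into the bound.
lemma3p19 : (n : ℕ) (G H : Digraph n) (w : Fin n → ℤ) →
    IsForwardDAG G → IsSubgraph H G → PathConsistent H →
    IsWeightFunction H w → Admissible G H w →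
    Σ (Fin n → ℚ) λ d →
      (∀ (u v : Fin n) → Connected H u v → d u ≡ d v) ×
      (∀ (v v' : Fin n) → CompEdge G H v v' →
         - 1ℚ < (toℚ (wd w v v') + d v) - d v')
lemma3p19 n G H w _ _ _ _ admissible =
  let (q , constant , compatible) = ConstraintGraph.integer-potential G H w admissible
      d : Fin n → ℚ
      d v = q v / suc n
  in d , (λ u v connected → cong (_/ suc n) (constant (proj₁ connected)))
       , (λ v v' e → RationalEstimate.rational-estimate (wd w v v') (q v) (q v') n (compatible v v' e))
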